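{- Let $A_5$ be the set of integers $0<n\le 99999$ whose five-digit decimal representation (leading zeros allowed) does not have all digits equal. For $n\in A_5$ let $(a_0\,b_0\,c_0\,d_0\,e_0)$ be its digits with $a_0\ge b_0\ge c_0\ge d_0\ge e_0$, and define its parameters $p(n)=(\alpha,\beta)$ with $\alpha=a_0-e_0$, $\beta=b_0-d_0$ (so $0<\alpha\le9$, $0\le\beta\le\alpha$). Let $K(n)=X-Y$ with $X=(a_0\,b_0\,c_0\,d_0\,e_0)$, $Y=(e_0\,d_0\,c_0\,b_0\,a_0)$. Let $n\in A_5$ with $p(n)=(\alpha,\beta)$ and write $p(K(n))=(\alpha',\beta')$. Then: If $\beta\ge1$: (K1) if $\alpha\ge\beta+1$, $5\le\beta\le8$, then $(\alpha',\beta')=(\alpha-1,\,\alpha+\beta-9)$; (K2) if $\alpha\ge6$, $2\le\beta\le5$, $\alpha+\beta\ge11$, then $(\alpha',\beta')=(\alpha-1,\,\alpha-\beta+1)$; (K5) if $\alpha\ge5$, $\alpha+\beta\le9$, then $(\alpha',\beta')=(10-\beta,\,\alpha-\beta-1)$; (K6) if $\alpha\le5$, $\alpha\ge\beta+1$, then $(\alpha',\beta')=(10-\beta,\,9-\alpha-\beta)$; (K9) if $\alpha\le\beta+1$, $\alpha+\beta\ge11$, then $(\alpha',\beta')=(\beta,\,2\alpha-10)$; (K10) if $\alpha\ge5$, $\beta\ge5$, $\alpha+\beta\le11$, then $(\alpha',\beta')=(\beta,\,\alpha-\beta+1)$; (K13) if $\alpha\le5$, $\beta\le5$, $\alpha+\beta\ge9$,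 then $(\alpha',\beta')=(10-\beta,\,1-\alpha+\beta)$; (K14) if $\beta\le\alpha\le\beta+1$, $\alpha+\beta\le9$, then $(\alpha',\beta')=(10-\beta,\,10-2\alpha)$; (K17) if $\alpha\ge\beta+1$, $9\le\alpha+\beta\le11$, then $(\alpha',\beta')=(10-\beta,\,2\alpha-10)$; (K18) if $\alpha\ge5$, $\beta\le5$, $\beta\le\alpha\le\beta+1$, then $(\alpha',\beta')=(10-\beta,\,\alpha+\beta-9)$; (K21) if $\alpha=\beta=5$, then $(\alpha',\beta')=(\beta,\,11-\alpha-\beta)$. If $\beta=0$: (K25) if $6\le\alpha\le9$, then $(\alpha',\beta')=(\alpha-1,\,10-\alpha)$; (K26) if $0<\alpha\le5$, then $(\alpha',\beta')=(10-\alpha,\,\alpha-1)$.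
   Context: $(a\,b\,c\,d\,e)$ denotes $a\cdot10^4+b\cdot10^3+c\cdot10^2+d\cdot10+e$. The parameters of $K(n)$ are computed from its five-digit representation (leading zeros allowed) in the same way as for $n$. -}

module Defs where

open import Data.Nat using (ℕ; zero; suc; _+_; _*_; _∸_; _≤_; _<_; _≤ᵇ_)
open import Data.Nat.DivMod using (_/_; _%_)
open import Data.Bool using (if_then_else_)
open import Data.List using (List; []; _∷_)
open import Data.Product using (_×_)
open import Relation.Nullary using (¬_)
open import Relation.Binary.PropositionalEquality using (_≡_)

num5 : ℕ → ℕ → ℕ → ℕ → ℕ → ℕ
num5 a b c d e = a * 10000 + b * 1000 + c * 100 + d * 10 + e

digit : ℕ → ℕ → ℕ
digit n k = (n / suc (k ∸ 1)) % 10   -- k ≥ 1 (always 1,10,100,1000,10000 here), so this is ⌊n/k⌋ mod 10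

digits5 : ℕ → List ℕ
digits5 n = digit n 10000 ∷ digit n 1000 ∷ digit n 100 ∷ digit n 10 ∷ digit n 1 ∷ []

insertDesc : ℕ → List ℕ → List ℕ
insertDesc x [] = x ∷ []
insertDesc x (y ∷ ys) = if y ≤ᵇ x then x ∷ y ∷ ys else y ∷ insertDesc x ys

sortDesc : List ℕ → List ℕ
sortDesc [] = []
sortDesc (x ∷ xs) = insertDesc x (sortDesc xs)

-- k-th entry of a list (0 if out of range; never used out of range here)
nth : List ℕ → ℕ → ℕ
nth [] _ = 0
nth (x ∷ xs) zero = x
nth (x ∷ xs) (suc k) = nth xs k

sdig : ℕ → ℕ → ℕ
sdig n k = nth (sortDesc (digits5 n)) k

a₀ b₀ c₀ d₀ e₀ : ℕ → ℕ
a₀ n = sdig n 0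
b₀ n = sdig n 1
c₀ n = sdig n 2
d₀ n = sdig n 3
e₀ n = sdig n 4

AllDigitsEqual : ℕ → Set
AllDigitsEqual n = (digit n 10000 ≡ digit n 1000) × (digit n 1000 ≡ digit n 100)
                 × (digit n 100 ≡ digit n 10) × (digit n 10 ≡ digit n 1)

A₅ : ℕ → Set
A₅ n = (0 < n) × (n ≤ 99999) × ¬ AllDigitsEqual n

α : ℕ → ℕ
α n = a₀ n ∸ e₀ n

β : ℕ → ℕ
β n = b₀ n ∸ d₀ n

K : ℕ → ℕ
K n = num5 (a₀ n) (b₀ n) (c₀ n) (d₀ n) (e₀ n) ∸ num5 (e₀ n) (d₀ n) (c₀ n) (b₀ n) (a₀ n)

{-# OPTIONS --safe #-}
module Submission where

-- Writing the sorted digits as a ≥ b ≥ c ≥ d ≥ e, the Kaprekar difference is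
-- (a - e)(10⁴ - 1) + (b - d)(10³ - 10), so K(n) = 9999 α + 990 β depends on the
-- parameters p(n) = (α, β) alone.  Since 0 ≤ β ≤ α ≤ 9, every clause of the
-- theorem is then a check on one of the 55 possible parameter pairs.

open import Defs
open import Data.Nat using (ℕ; suc; _+_; _*_; _∸_; _≤_; _<_; _≥_; _≤ᵇ_; s≤s; _≟_; _≤?_)
open import Data.Nat.Properties
  using (≤-pred; ≤-trans; ≰⇒≥; m∸n≤m; ∸-mono; m∸n+n≡m; m+n∸n≡m; ≤ᵇ-reflects-≤; allUpTo?)
open import Data.Nat.DivMod using (_/_; m%n<n)
open import Data.Nat.Solver using (module +-*-Solver)
open import Data.Bool using (true; false)
open import Data.Unit using (tt)
open import Data.List using ([]; _∷_; length)
open import Data.List.Relation.Unary.All using (All; []; _∷_)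
open import Data.List.Relation.Unary.Linked using (Linked; [-]; _∷_)
open import Data.Product using (_×_)
open import Relation.Nullary using (Dec)
open import Relation.Nullary.Reflects using (ofʸ; ofⁿ)
open import Relation.Nullary.Decidable using (_×-dec_; _→-dec_; toWitness)
open import Relation.Binary.PropositionalEquality
  using (_≡_; refl; cong; cong₂; sym; trans; subst; module ≡-Reasoning)

insertDesc-linked : ∀ {k x ys} → x ≤ k → Linked _≥_ (k ∷ ys) → Linked _≥_ (k ∷ insertDesc x ys)
insertDesc-linked {ys = []} x≤k [-] = x≤k ∷ [-]
insertDesc-linked {x = x} {ys = y ∷ _} x≤k (y≤k ∷ linked)
  with y ≤ᵇ x | ≤ᵇ-reflects-≤ y x
... | _ | ofʸ y≤x = x≤k ∷ y≤x ∷ linked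
... | _ | ofⁿ y≰x = y≤k ∷ insertDesc-linked (≰⇒≥ y≰x) linked

sortDesc-linked : ∀ {k xs} → All (_≤ k) xs → Linked _≥_ (k ∷ sortDesc xs)
sortDesc-linked []             = [-]
sortDesc-linked (x≤k ∷ xs≤k) = insertDesc-linked x≤k (sortDesc-linked xs≤k)

length-insertDesc : ∀ x ys → length (insertDesc x ys) ≡ suc (length ys)
length-insertDesc x [] = refl
length-insertDesc x (y ∷ ys) with y ≤ᵇ x
... | true  = refl
... | false = cong suc (length-insertDesc x ys)

length-sortDesc : ∀ xs → length (sortDesc xs) ≡ length xs
length-sortDesc []       = refl
length-sortDesc (x ∷ xs) = trans (length-insertDesc x (sortDesc xs)) (cong suc (length-sortDesc xs))

fiveEntries : ∀ xs → length xs ≡ 5 → xs ≡ nth xs 0 ∷ nth xs 1 ∷ nth xs 2 ∷ nth xs 3 ∷ nth xs 4 ∷ []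
fiveEntries (_ ∷ _ ∷ _ ∷ _ ∷ _ ∷ []) refl = refl

digit≤9 : ∀ n k → digit n k ≤ 9
digit≤9 n k = ≤-pred (m%n<n (n / suc (k ∸ 1)) 10)

sortedDigits : ∀ n → Linked _≥_ (9 ∷ a₀ n ∷ b₀ n ∷ c₀ n ∷ d₀ n ∷ e₀ n ∷ [])
sortedDigits n = subst (λ xs → Linked _≥_ (9 ∷ xs))
  (fiveEntries (sortDesc (digits5 n)) (length-sortDesc (digits5 n)))
  (sortDesc-linked (digit≤9 n 10000 ∷ digit≤9 n 1000 ∷ digit≤9 n 100 ∷ digit≤9 n 10 ∷ digit≤9 n 1 ∷ []))

α≤9 : ∀ n → α n ≤ 9
α≤9 n with sortedDigits n
... | a≤9 ∷ _ = ≤-trans (m∸n≤m (a₀ n) (e₀ n)) a≤9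

β≤α : ∀ n → β n ≤ α n
β≤α n with sortedDigits n
... | _ ∷ b≤a ∷ _ ∷ _ ∷ e≤d ∷ [-] = ∸-mono b≤a e≤d

Kᵖ : ℕ → ℕ → ℕ
Kᵖ A B = 9999 * A + 990 * B

num5-swapEnds : ∀ A B c d e →
  num5 (A + e) (B + d) c d e ≡ Kᵖ A B + num5 e d c (B + d) (A + e)
num5-swapEnds = solve 5
  (λ A B c d e →
    (A :+ e) :* con 10000 :+ (B :+ d) :* con 1000 :+ c :* con 100 :+ d :* con 10 :+ e
    := (con 9999 :* A :+ con 990 :* B)
       :+ (e :* con 10000 :+ d :* con 1000 :+ c :* con 100 :+ (B :+ d) :* con 10 :+ (A :+ e)))
  refl
  where open +-*-Solver

num5-∸-reverse : ∀ {a b d e} c → e ≤ a → d ≤ b →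
  num5 a b c d e ∸ num5 e d c b a ≡ Kᵖ (a ∸ e) (b ∸ d)
num5-∸-reverse {a} {b} {d} {e} c e≤a d≤b = begin
  num5 a b c d e ∸ num5 e d c b a
    ≡⟨ cong₂ (λ x y → num5 x y c d e ∸ num5 e d c y x) (sym (m∸n+n≡m e≤a)) (sym (m∸n+n≡m d≤b)) ⟩
  num5 (A + e) (B + d) c d e ∸ num5 e d c (B + d) (A + e)
    ≡⟨ cong (_∸ num5 e d c (B + d) (A + e)) (num5-swapEnds A B c d e) ⟩
  Kᵖ A B + num5 e d c (B + d) (A + e) ∸ num5 e d c (B + d) (A + e)
    ≡⟨ m+n∸n≡m (Kᵖ A B) (num5 e d c (B + d) (A + e)) ⟩
  Kᵖ A B ∎
  where
  open ≡-Reasoning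
  A = a ∸ e
  B = b ∸ d

K≡Kᵖ : ∀ n → K n ≡ Kᵖ (α n) (β n)
K≡Kᵖ n with sortedDigits n
... | _ ∷ b≤a ∷ c≤b ∷ d≤c ∷ e≤d ∷ [-] =
  num5-∸-reverse (c₀ n) (≤-trans e≤d (≤-trans d≤c (≤-trans c≤b b≤a))) (≤-trans d≤c c≤b)

KaprekarTransitions : ℕ → ℕ → ℕ → ℕ → Set
KaprekarTransitions A B A′ B′ =
    ((1 ≤ B) →
      ((B + 1 ≤ A → 5 ≤ B → B ≤ 8 →
          (A′ ≡ A ∸ 1) × (B′ ≡ (A + B) ∸ 9))
      × (6 ≤ A → 2 ≤ B → B ≤ 5 → 11 ≤ A + B →
          (A′ ≡ A ∸ 1) × (B′ ≡ (A ∸ B) + 1))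
      × (5 ≤ A → A + B ≤ 9 →
          (A′ ≡ 10 ∸ B) × (B′ ≡ (A ∸ B) ∸ 1))
      × (A ≤ 5 → B + 1 ≤ A →
          (A′ ≡ 10 ∸ B) × (B′ ≡ 9 ∸ (A + B)))
      × (A ≤ B + 1 → 11 ≤ A + B →
          (A′ ≡ B) × (B′ ≡ 2 * A ∸ 10))
      × (5 ≤ A → 5 ≤ B → A + B ≤ 11 →
          (A′ ≡ B) × (B′ ≡ (A ∸ B) + 1))
      × (A ≤ 5 → B ≤ 5 → 9 ≤ A + B →
          (A′ ≡ 10 ∸ B) × (B′ ≡ (1 + B) ∸ A))
      × (B ≤ A → A ≤ B + 1 → A + B ≤ 9 →
          (A′ ≡ 10 ∸ B) × (B′ ≡ 10 ∸ 2 * A))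
      × (B + 1 ≤ A → 9 ≤ A + B → A + B ≤ 11 →
          (A′ ≡ 10 ∸ B) × (B′ ≡ 2 * A ∸ 10))
      × (5 ≤ A → B ≤ 5 → B ≤ A → A ≤ B + 1 →
          (A′ ≡ 10 ∸ B) × (B′ ≡ (A + B) ∸ 9))
      × (A ≡ 5 → B ≡ 5 →
          (A′ ≡ B) × (B′ ≡ 11 ∸ (A + B)))))
    × ((B ≡ 0) →
      ((6 ≤ A → A ≤ 9 →
          (A′ ≡ A ∸ 1) × (B′ ≡ 10 ∸ A))
      × (1 ≤ A → A ≤ 5 →
          (A′ ≡ 10 ∸ A) × (B′ ≡ A ∸ 1))))

kaprekarTransitions? : ∀ A B A′ B′ → Dec (KaprekarTransitions A B A′ B′)
kaprekarTransitions? A B A′ B′ =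
    ((1 ≤? B) →-dec
      ((B + 1 ≤? A →-dec 5 ≤? B →-dec B ≤? 8 →-dec
          (A′ ≟ A ∸ 1) ×-dec (B′ ≟ (A + B) ∸ 9))
      ×-dec (6 ≤? A →-dec 2 ≤? B →-dec B ≤? 5 →-dec 11 ≤? A + B →-dec
          (A′ ≟ A ∸ 1) ×-dec (B′ ≟ (A ∸ B) + 1))
      ×-dec (5 ≤? A →-dec A + B ≤? 9 →-dec
          (A′ ≟ 10 ∸ B) ×-dec (B′ ≟ (A ∸ B) ∸ 1))
      ×-dec (A ≤? 5 →-dec B + 1 ≤? A →-dec
          (A′ ≟ 10 ∸ B) ×-dec (B′ ≟ 9 ∸ (A + B)))
      ×-dec (A ≤? B + 1 →-dec 11 ≤? A + B →-dec
          (A′ ≟ B) ×-dec (B′ ≟ 2 * A ∸ 10))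
      ×-dec (5 ≤? A →-dec 5 ≤? B →-dec A + B ≤? 11 →-dec
          (A′ ≟ B) ×-dec (B′ ≟ (A ∸ B) + 1))
      ×-dec (A ≤? 5 →-dec B ≤? 5 →-dec 9 ≤? A + B →-dec
          (A′ ≟ 10 ∸ B) ×-dec (B′ ≟ (1 + B) ∸ A))
      ×-dec (B ≤? A →-dec A ≤? B + 1 →-dec A + B ≤? 9 →-dec
          (A′ ≟ 10 ∸ B) ×-dec (B′ ≟ 10 ∸ 2 * A))
      ×-dec (B + 1 ≤? A →-dec 9 ≤? A + B →-dec A + B ≤? 11 →-dec
          (A′ ≟ 10 ∸ B) ×-dec (B′ ≟ 2 * A ∸ 10))
      ×-dec (5 ≤? A →-dec B ≤? 5 →-dec B ≤? A →-dec A ≤? B + 1 →-dec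
          (A′ ≟ 10 ∸ B) ×-dec (B′ ≟ (A + B) ∸ 9))
      ×-dec (A ≟ 5 →-dec B ≟ 5 →-dec
          (A′ ≟ B) ×-dec (B′ ≟ 11 ∸ (A + B)))))
    ×-dec ((B ≟ 0) →-dec
      ((6 ≤? A →-dec A ≤? 9 →-dec
          (A′ ≟ A ∸ 1) ×-dec (B′ ≟ 10 ∸ A))
      ×-dec (1 ≤? A →-dec A ≤? 5 →-dec
          (A′ ≟ 10 ∸ A) ×-dec (B′ ≟ A ∸ 1))))

transitionTable : ∀ {A B} → A ≤ 9 → B ≤ A → KaprekarTransitions A B (α (Kᵖ A B)) (β (Kᵖ A B))
transitionTable A≤9 B≤A = toWitness {a? = allPairs?} tt (s≤s A≤9) (s≤s B≤A)
  where
  allPairs? : Dec (∀ {A} → A < 10 → ∀ {B} → B < suc A →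
                   KaprekarTransitions A B (α (Kᵖ A B)) (β (Kᵖ A B)))
  allPairs? = allUpTo? (λ A → allUpTo? (λ B →
    kaprekarTransitions? A B (α (Kᵖ A B)) (β (Kᵖ A B))) (suc A)) 10

mainTheorem4 : (n : ℕ) → A₅ n →
  ((1 ≤ β n) →
    -- (K1)
    ((β n + 1 ≤ α n → 5 ≤ β n → β n ≤ 8 →
        (α (K n) ≡ α n ∸ 1) × (β (K n) ≡ (α n + β n) ∸ 9))
    -- (K2)
    × (6 ≤ α n → 2 ≤ β n → β n ≤ 5 → 11 ≤ α n + β n →
        (α (K n) ≡ α n ∸ 1) × (β (K n) ≡ (α n ∸ β n) + 1))
    -- (K5)
    × (5 ≤ α n → α n + β n ≤ 9 →
        (α (K n) ≡ 10 ∸ β n) × (β (K n) ≡ (α n ∸ β n) ∸ 1))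
    -- (K6)
    × (α n ≤ 5 → β n + 1 ≤ α n →
        (α (K n) ≡ 10 ∸ β n) × (β (K n) ≡ 9 ∸ (α n + β n)))
    -- (K9)
    × (α n ≤ β n + 1 → 11 ≤ α n + β n →
        (α (K n) ≡ β n) × (β (K n) ≡ 2 * α n ∸ 10))
    -- (K10)
    × (5 ≤ α n → 5 ≤ β n → α n + β n ≤ 11 →
        (α (K n) ≡ β n) × (β (K n) ≡ (α n ∸ β n) + 1))
    -- (K13)
    × (α n ≤ 5 → β n ≤ 5 → 9 ≤ α n + β n →
        (α (K n) ≡ 10 ∸ β n) × (β (K n) ≡ (1 + β n) ∸ α n))
    -- (K14)
    × (β n ≤ α n → α n ≤ β n + 1 → α n + β n ≤ 9 →
        (α (K n) ≡ 10 ∸ β n) × (β (K n) ≡ 10 ∸ 2 * α n))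
    -- (K17)
    × (β n + 1 ≤ α n → 9 ≤ α n + β n → α n + β n ≤ 11 →
        (α (K n) ≡ 10 ∸ β n) × (β (K n) ≡ 2 * α n ∸ 10))
    -- (K18)
    × (5 ≤ α n → β n ≤ 5 → β n ≤ α n → α n ≤ β n + 1 →
        (α (K n) ≡ 10 ∸ β n) × (β (K n) ≡ (α n + β n) ∸ 9))
    -- (K21)
    × (α n ≡ 5 → β n ≡ 5 →
        (α (K n) ≡ β n) × (β (K n) ≡ 11 ∸ (α n + β n)))))
  × ((β n ≡ 0) →
    -- (K25)
    ((6 ≤ α n → α n ≤ 9 →
        (α (K n) ≡ α n ∸ 1) × (β (K n) ≡ 10 ∸ α n))
    -- (K26)
    × (1 ≤ α n → α n ≤ 5 →
        (α (K n) ≡ 10 ∸ α n) × (β (K n) ≡ α n ∸ 1))))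
mainTheorem4 n _ =
  subst (λ m → KaprekarTransitions (α n) (β n) (α m) (β m)) (sym (K≡Kᵖ n))
    (transitionTable (α≤9 n) (β≤α n))
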